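{- Let $G$ be a nut graph of order $n$ such that $\mathrm{Aut}(G)$ has precisely two orbits on $V(G)$. Then $n$ is not a prime number.
   Context: A nut graph is a simple connected graph whose adjacency matrix has one-dimensional kernel spanned by a vector with no zero entry. $\mathrm{Aut}(G)$ is the full automorphism group of $G$. -}

module Defs where

open import Data.Nat using (ℕ; zero; suc; _≤_)
open import Data.Fin using (Fin; zero; suc)
open import Data.Fin.Permutation using (Permutation′; _⟨$⟩ʳ_)
open import Data.Bool using (Bool; true; false; if_then_else_)
open import Data.Rational using (ℚ; 0ℚ; 1ℚ; _+_; _*_)
open import Data.Product using (Σ; ∃; _×_; _,_)
open import Data.Sum using (_⊎_)
open import Relation.Binary.PropositionalEquality using (_≡_; _≢_)
open import Relation.Nullary using (¬_)

record Graph (n : ℕ) : Set where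
  field
    adj    : Fin n → Fin n → Bool
    symm   : ∀ u v → adj u v ≡ adj v u
    irrefl : ∀ v → adj v v ≡ false
open Graph public

data Reachable {n : ℕ} (G : Graph n) : Fin n → Fin n → Set where
  here : ∀ {u} → Reachable G u u
  step : ∀ {u v w} → adj G u v ≡ true → Reachable G v w → Reachable G u w

Connected : ∀ {n} → Graph n → Set
Connected {n} G = (1 ≤ n) × (∀ u v → Reachable G u v)

sumℚ : ∀ {n} → (Fin n → ℚ) → ℚ
sumℚ {zero}  f = 0ℚ
sumℚ {suc n} f = f zero + sumℚ (λ i → f (suc i))

adjMat : ∀ {n} → Graph n → Fin n → Fin n → ℚ
adjMat G u v = if adj G u v then 1ℚ else 0ℚ

InKernel : ∀ {n} → Graph n → (Fin n → ℚ) → Set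
InKernel G x = ∀ u → sumℚ (λ v → adjMat G u v * x v) ≡ 0ℚ

-- nut graph: connected, and the kernel of A is one-dimensional, spanned by
-- a vector x with no zero entry (x ≠ 0 since n ≥ 1 and all entries nonzero)
IsNut : ∀ {n} → Graph n → Set
IsNut {n} G =
  Connected G ×
  Σ (Fin n → ℚ) λ x →
    InKernel G x ×
    (∀ v → x v ≢ 0ℚ) ×
    (∀ y → InKernel G y → ∃ λ (c : ℚ) → ∀ v → y v ≡ c * x v)

IsAutomorphism : ∀ {n} → Graph n → Permutation′ n → Set
IsAutomorphism G π = ∀ u v → adj G (π ⟨$⟩ʳ u) (π ⟨$⟩ʳ v) ≡ adj G u v

SameOrbit : ∀ {n} → Graph n → Fin n → Fin n → Set
SameOrbit G u v = ∃ λ π → IsAutomorphism G π × (π ⟨$⟩ʳ u ≡ v)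

HasTwoOrbits : ∀ {n} → Graph n → Set
HasTwoOrbits {n} G =
  Σ (Fin n) λ a → Σ (Fin n) λ b →
    ¬ SameOrbit G a b × (∀ v → SameOrbit G a v ⊎ SameOrbit G b v)

module Submission where

-- Colour the vertices by their Aut(G)-orbit. Automorphisms preserve the number of neighbours a vertex has in
-- each orbit, so this is an equitable partition into two cells of sizes n₁ + n₂ = n: every vertex of cell i has
-- dᵢⱼ neighbours in cell j. Counting the edges between the cells gives n₁ d₁₂ = n₂ d₂₁. If n is prime then n₁
-- and n₂ are coprime, so n₂ divides d₁₂; as 0 < d₁₂ ≤ n₂ by connectivity, d₁₂ = n₂ and the cells are completely
-- joined. Summing the kernel equations of the full kernel vector x over each cell gives a linear system for the
-- two cell sums of x with matrix (dᵢⱼ), which is nonsingular since dᵢᵢ < nᵢ = dⱼᵢ. Hence both cell sums vanish,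
-- and then x restricted to the first cell is again a kernel vector. It vanishes on the second cell but not on
-- the first, contradicting that the kernel is spanned by x.

open import Defs
open import Data.Nat.Primality using (Prime)
open import Relation.Nullary using (¬_; Dec; yes; no; does)

open import Algebra.Bundles using (CommutativeSemiring; CommutativeRing)
import Algebra.Properties.Semiring.Sum as SemiringSum
open import Data.Bool using (Bool; true; false; not; if_then_else_)
open import Data.Bool.Properties using (_≟_; not-¬)
open import Data.Empty using (⊥-elim)
open import Data.Fin using (Fin; zero; suc)
open import Data.Fin.Permutation as Perm using (_⟨$⟩ʳ_; _⟨$⟩ˡ_; _∘ₚ_)
open import Data.Fin.Properties using (sequence)
open import Data.Nat as ℕ using (ℕ; zero; suc; _≤_; _<_; s≤s; z≤n)
open import Data.Nat.Coprimality using (Coprime; coprime-divisor; prime⇒coprime)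
open import Data.Nat.Divisibility using (_∣_; divides; ∣⇒≤; ∣m∣n⇒∣m+n)
import Data.Nat.Properties as ℕ
open import Data.Product using (_×_; _,_; proj₁; proj₂)
open import Data.Rational as ℚ using (ℚ; 0ℚ; 1ℚ)
import Data.Rational.Properties as ℚ
open import Data.Rational.Solver using (module +-*-Solver)
open import Algebra.Properties.Group ℚ.+-0-group using (x∙y⁻¹≈ε⇒x≈y)
open import Data.Sum using (_⊎_; [_,_])
open import Effect.Monad using (RawMonad)
open import Function using (id; _∘_)
open import Level using (0ℓ)
open import Relation.Binary.PropositionalEquality as ≡ using (_≡_; _≢_; cong)
open import Relation.Nullary.Decidable using (¬¬-excluded-middle)
open import Relation.Nullary.Negation using (¬¬-Monad)

module ℕ∑ = SemiringSum ℕ.+-*-semiring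

module AdjacencyAlgebra {c ℓ} (R : CommutativeSemiring c ℓ) where

  open CommutativeSemiring R hiding (zero)
  open import Algebra.Properties.CommutativeSemigroup *-commutativeSemigroup using (x∙yz≈z∙yx)
  open import Algebra.Properties.Semiring.Sum semiring
  open import Relation.Binary.Reasoning.Setoid setoid

  𝟙 : Bool → Carrier
  𝟙 b = if b then 1# else 0#

  module _ {n : ℕ} (G : Graph n) where

    A : Fin n → Fin n → Carrier
    A u v = 𝟙 (adj G u v)

    A-sym : ∀ u v → A u v ≡ A v u
    A-sym u v = cong 𝟙 (symm G u v)

    A-automorphism : ∀ {π} → IsAutomorphism G π → ∀ u v → A (π ⟨$⟩ʳ u) (π ⟨$⟩ʳ v) ≡ A u v
    A-automorphism aut u v = cong 𝟙 (aut u v)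

    adjMul : (Fin n → Carrier) → Fin n → Carrier
    adjMul x u = ∑[ v < n ] (A u v * x v)

    adjMul-swap : ∀ f g → ∑[ u < n ] (f u * adjMul g u) ≈ ∑[ v < n ] (g v * adjMul f v)
    adjMul-swap f g = begin
      ∑[ u < n ] (f u * adjMul g u)
        ≈⟨ sum-cong-≋ (λ u → *-distribˡ-sum (f u) (λ v → A u v * g v)) ⟩
      ∑[ u < n ] ∑[ v < n ] (f u * (A u v * g v))
        ≈⟨ ∑-comm (λ u v → f u * (A u v * g v)) ⟩
      ∑[ v < n ] ∑[ u < n ] (f u * (A u v * g v))
        ≈⟨ sum-cong-≋ (λ v → sum-cong-≋ (λ u → term u v)) ⟩
      ∑[ v < n ] ∑[ u < n ] (g v * (A v u * f u))
        ≈⟨ sum-cong-≋ (λ v → *-distribˡ-sum (g v) (λ u → A v u * f u)) ⟨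
      ∑[ v < n ] (g v * adjMul f v)
        ∎
      where
      term : ∀ u v → f u * (A u v * g v) ≈ g v * (A v u * f u)
      term u v rewrite A-sym u v = x∙yz≈z∙yx (f u) (A v u) (g v)

    adjMul-automorphism : ∀ {π} → IsAutomorphism G π → ∀ {x : Fin n → Carrier} →
                          (∀ v → x (π ⟨$⟩ʳ v) ≈ x v) → ∀ u → adjMul x (π ⟨$⟩ʳ u) ≈ adjMul x u
    adjMul-automorphism {π} aut {x} x-invariant u = begin
      ∑[ v < n ] (A (π ⟨$⟩ʳ u) v * x v)
        ≈⟨ ∑-permute (λ v → A (π ⟨$⟩ʳ u) v * x v) π ⟩
      ∑[ w < n ] (A (π ⟨$⟩ʳ u) (π ⟨$⟩ʳ w) * x (π ⟨$⟩ʳ w))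
        ≈⟨ sum-cong-≋ term ⟩
      ∑[ w < n ] (A u w * x w)
        ∎
      where
      term : ∀ w → A (π ⟨$⟩ʳ u) (π ⟨$⟩ʳ w) * x (π ⟨$⟩ʳ w) ≈ A u w * x w
      term w = *-cong (reflexive (A-automorphism {π} aut u w)) (x-invariant w)

    module Cells (o : Fin n → Bool) where

      restrict : Bool → (Fin n → Carrier) → Fin n → Carrier
      restrict β x v = if does (o v ≟ β) then x v else 0#

      cellSum : Bool → (Fin n → Carrier) → Carrier
      cellSum β x = ∑[ v < n ] restrict β x v

      indicator : Bool → Fin n → Carrier
      indicator β = restrict β (λ _ → 1#)

      size : Bool → Carrier
      size β = cellSum β (λ _ → 1#)

      deg : Bool → Fin n → Carrier
      deg β = adjMul (indicator β)

      restrict-split : ∀ x v → x v ≈ restrict true x v + restrict false x v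
      restrict-split x v with o v
      ... | true  = sym (+-identityʳ (x v))
      ... | false = sym (+-identityˡ (x v))

      restrict≈indicator* : ∀ β x v → restrict β x v ≈ indicator β v * x v
      restrict≈indicator* β x v with o v ≟ β
      ... | yes _ = sym (*-identityˡ (x v))
      ... | no  _ = sym (zeroˡ (x v))

      ∑-cells : ∀ x → ∑[ v < n ] x v ≈ cellSum true x + cellSum false x
      ∑-cells x = trans (sum-cong-≋ (restrict-split x)) (∑-distrib-+ (restrict true x) (restrict false x))

      cellSum-const : ∀ β {f k} → (∀ v → o v ≡ β → f v ≈ k) → cellSum β f ≈ size β * k
      cellSum-const β {f} {k} f-const = trans (sum-cong-≋ term) (sym (*-distribʳ-sum k (indicator β)))
        where
        term : ∀ v → restrict β f v ≈ indicator β v * k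
        term v with o v ≟ β
        ... | yes ov = trans (f-const v ov) (sym (*-identityˡ k))
        ... | no  _  = sym (zeroˡ k)

      cellSum-adjMul : ∀ γ g → cellSum γ (adjMul g) ≈ ∑[ v < n ] (g v * deg γ v)
      cellSum-adjMul γ g = trans (sum-cong-≋ (restrict≈indicator* γ (adjMul g))) (adjMul-swap _ g)

      cellSum-deg-comm : ∀ γ β → cellSum γ (deg β) ≈ cellSum β (deg γ)
      cellSum-deg-comm γ β = begin
        cellSum γ (deg β)                     ≈⟨ cellSum-adjMul γ (indicator β) ⟩
        ∑[ v < n ] (indicator β v * deg γ v)  ≈⟨ sum-cong-≋ (restrict≈indicator* β (deg γ)) ⟨
        cellSum β (deg γ)                     ∎

      ∑-cellwise : ∀ (x : Fin n → Carrier) {f : Fin n → Carrier} (e : Bool → Carrier) →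
                   (∀ v → f v ≈ e (o v)) →
                   ∑[ v < n ] (x v * f v) ≈ cellSum true x * e true + cellSum false x * e false
      ∑-cellwise x {f} e f-cellwise = begin
        ∑[ v < n ] (x v * f v)
          ≈⟨ sum-cong-≋ term ⟩
        ∑[ v < n ] (restrict true x v * e true + restrict false x v * e false)
          ≈⟨ ∑-distrib-+ (λ v → restrict true x v * e true) (λ v → restrict false x v * e false) ⟩
        ∑[ v < n ] (restrict true x v * e true) + ∑[ v < n ] (restrict false x v * e false)
          ≈⟨ +-cong (*-distribʳ-sum (e true) (restrict true x))
                    (*-distribʳ-sum (e false) (restrict false x)) ⟨
        cellSum true x * e true + cellSum false x * e false
          ∎
        where
        term : ∀ v → x v * f v ≈ restrict true x v * e true + restrict false x v * e false
        term v with o v | f-cellwise v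
        ... | true  | fv =
          trans (*-congˡ fv) (trans (sym (+-identityʳ (x v * e true))) (+-congˡ (sym (zeroˡ (e false)))))
        ... | false | fv =
          trans (*-congˡ fv) (trans (sym (+-identityˡ (x v * e false))) (+-congʳ (sym (zeroˡ (e true)))))

      adjMul-cells : ∀ x u → adjMul x u ≈ adjMul (restrict true x) u + adjMul (restrict false x) u
      adjMul-cells x u = trans (sum-cong-≋ term)
        (∑-distrib-+ (λ v → A u v * restrict true x v) (λ v → A u v * restrict false x v))
        where
        term : ∀ v → A u v * x v ≈ A u v * restrict true x v + A u v * restrict false x v
        term v = trans (*-congˡ (restrict-split x v)) (distribˡ _ _ _)

      restrict-in : ∀ {β} x {v} → o v ≡ β → restrict β x v ≡ x v
      restrict-in {β} x {v} ov with o v ≟ β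
      ... | yes _  = ≡.refl
      ... | no  ne = ⊥-elim (ne ov)

      restrict-out : ∀ {β} x {v} → o v ≢ β → restrict β x v ≡ 0#
      restrict-out {β} x {v} ov≢β with o v ≟ β
      ... | yes ov = ⊥-elim (ov≢β ov)
      ... | no  _  = ≡.refl

      cellSum-zero : ∀ β {x} → (∀ v → x v ≈ 0#) → cellSum β x ≈ 0#
      cellSum-zero β {x} x≈0 = trans (sum-cong-≋ term) (sum-replicate-zero n)
        where
        term : ∀ v → restrict β x v ≈ 0#
        term v with o v ≟ β
        ... | yes _ = x≈0 v
        ... | no  _ = refl

      deg-automorphism : ∀ {π} → IsAutomorphism G π → (∀ v → o (π ⟨$⟩ʳ v) ≡ o v) →
                         ∀ β u → deg β (π ⟨$⟩ʳ u) ≈ deg β u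
      deg-automorphism {π} aut o-invariant β =
        adjMul-automorphism {π} aut (λ v → reflexive (cong (λ b → 𝟙 (does (b ≟ β))) (o-invariant v)))

      adjMul-restrict-joined : ∀ β x u → (∀ v → o v ≡ β → adj G u v ≡ true) →
                               adjMul (restrict β x) u ≈ cellSum β x
      adjMul-restrict-joined β x u joined = sum-cong-≋ term
        where
        term : ∀ v → A u v * restrict β x v ≈ restrict β x v
        term v with o v ≟ β
        ... | yes ov rewrite joined v ov = *-identityˡ (x v)
        ... | no  _  = zeroʳ (A u v)

module Cast {c ℓ} (R : CommutativeSemiring c ℓ) where

  open CommutativeSemiring R hiding (zero)
  open import Algebra.Properties.Semiring.Mult semiring as Mult using (×-homo-1; ×-homo-+; ×1-homo-*)
  open import Algebra.Properties.Semiring.Sum semiring using (sum-syntax; sum-cong-≋)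
  module ℕA = AdjacencyAlgebra ℕ.+-*-commutativeSemiring
  module RA = AdjacencyAlgebra R

  cast : ℕ → Carrier
  cast m = m Mult.× 1#

  cast-∑ : ∀ {m} (f : Fin m → ℕ) → cast (ℕ∑.sum f) ≈ ∑[ i < m ] cast (f i)
  cast-∑ {zero}  f = refl
  cast-∑ {suc m} f = trans (×-homo-+ 1# (f zero) _) (+-congˡ (cast-∑ (λ i → f (suc i))))

  cast-𝟙 : ∀ b → cast (ℕA.𝟙 b) ≈ RA.𝟙 b
  cast-𝟙 true  = ×-homo-1 1#
  cast-𝟙 false = refl

  cast-* : ∀ m k → cast (m ℕ.* k) ≈ cast m * cast k
  cast-* = ×1-homo-*

  cast-deg : ∀ {n} (G : Graph n) (o : Fin n → Bool) β v → cast (ℕA.Cells.deg G o β v) ≈ RA.Cells.deg G o β v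
  cast-deg G o β v = trans (cast-∑ (λ u → ℕA.A G v u ℕ.* ℕA.Cells.indicator G o β u)) (sum-cong-≋ term)
    where
    term : ∀ u → cast (ℕA.A G v u ℕ.* ℕA.Cells.indicator G o β u) ≈
                 RA.A G v u * RA.Cells.indicator G o β u
    term u = trans (cast-* (ℕA.A G v u) _) (*-cong (cast-𝟙 (adj G v u)) (cast-𝟙 (does (o u ≟ β))))

open ≡ using (refl; sym; trans; subst; subst₂)

∑-mono-≤ : ∀ {m} {f g : Fin m → ℕ} → (∀ i → f i ≤ g i) → ℕ∑.sum f ≤ ℕ∑.sum g
∑-mono-≤ {zero}  f≤g = z≤n
∑-mono-≤ {suc m} f≤g = ℕ.+-mono-≤ (f≤g zero) (∑-mono-≤ (f≤g ∘ suc))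

∑-mono-< : ∀ {m} {f g : Fin m → ℕ} → (∀ i → f i ≤ g i) → ∀ j → f j < g j → ℕ∑.sum f < ℕ∑.sum g
∑-mono-< f≤g zero    fj<gj = ℕ.+-mono-<-≤ fj<gj (∑-mono-≤ (f≤g ∘ suc))
∑-mono-< f≤g (suc j) fj<gj = ℕ.+-mono-≤-< (f≤g zero) (∑-mono-< (f≤g ∘ suc) j fj<gj)

≤-∑ : ∀ {m} (f : Fin m → ℕ) j → f j ≤ ℕ∑.sum f
≤-∑ f zero    = ℕ.m≤m+n (f zero) _
≤-∑ f (suc j) = ℕ.≤-trans (≤-∑ (f ∘ suc) j) (ℕ.m≤n+m _ (f zero))

∑-const-1 : ∀ m → ℕ∑.sum {m} (λ _ → 1) ≡ m
∑-const-1 zero    = refl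
∑-const-1 (suc m) = cong suc (∑-const-1 m)

prime-sum-coprime : ∀ {m k} → Prime (m ℕ.+ k) → 0 < m → 0 < k → Coprime k m
prime-sum-coprime {m} p 0<m 0<k (d∣k , d∣m) =
  prime⇒coprime p {{ℕ.>-nonZero 0<m}} (ℕ.m<m+n m 0<k) (∣m∣n⇒∣m+n d∣m d∣k , d∣m)

prime-sum-divisor : ∀ {m k d} → Prime (m ℕ.+ k) → 0 < m → 0 < d → d ≤ k → k ∣ m ℕ.* d → d ≡ k
prime-sum-divisor p 0<m 0<d d≤k k∣md = ℕ.≤-antisym d≤k
  (∣⇒≤ {{ℕ.>-nonZero 0<d}} (coprime-divisor (prime-sum-coprime p 0<m (ℕ.<-≤-trans 0<d d≤k)) k∣md))

reachable-closed : ∀ {n} {G : Graph n} (P : Fin n → Set) →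
                   (∀ {u v} → adj G u v ≡ true → P u → P v) → ∀ {u v} → Reachable G u v → P u → P v
reachable-closed P closed here       = id
reachable-closed P closed (step e r) = reachable-closed P closed r ∘ closed e

module NatCells {n : ℕ} (G : Graph n) (o : Fin n → Bool) where

  open AdjacencyAlgebra ℕ.+-*-commutativeSemiring public
  open Cells G o public

  𝟙*𝟙≤𝟙 : ∀ a b → 𝟙 a ℕ.* 𝟙 b ≤ 𝟙 b
  𝟙*𝟙≤𝟙 true  true  = ℕ.≤-refl
  𝟙*𝟙≤𝟙 true  false = z≤n
  𝟙*𝟙≤𝟙 false b     = z≤n

  size-cells : size true ℕ.+ size false ≡ n
  size-cells = trans (sym (∑-cells (λ _ → 1))) (∑-const-1 n)

  size-pos : ∀ {β v} → o v ≡ β → 0 < size β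
  size-pos {β} {v} ov =
    ℕ.≤-trans (ℕ.≤-reflexive (sym (restrict-in (λ _ → 1) ov))) (≤-∑ (indicator β) v)

  deg-<-size : ∀ {β u v} → o v ≡ β → adj G u v ≡ false → deg β u < size β
  deg-<-size {β} {u} {v} ov nonadjacent =
    ∑-mono-< (λ w → 𝟙*𝟙≤𝟙 (adj G u w) (does (o w ≟ β))) v term
    where
    term : A G u v ℕ.* indicator β v < indicator β v
    term rewrite nonadjacent | restrict-in (λ _ → 1) ov = ℕ.≤-refl

  deg-≤-size : ∀ β u → deg β u ≤ size β
  deg-≤-size β u = ∑-mono-≤ (λ w → 𝟙*𝟙≤𝟙 (adj G u w) (does (o w ≟ β)))

  deg≡size⇒adjacent : ∀ {β u v} → deg β u ≡ size β → o v ≡ β → adj G u v ≡ true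
  deg≡size⇒adjacent {β} {u} {v} deg≡size ov with adj G u v in e
  ... | true  = refl
  ... | false = ⊥-elim (ℕ.<-irrefl deg≡size (deg-<-size ov e))

  adjacent⇒deg-pos : ∀ {β u v} → adj G u v ≡ true → o v ≡ β → 0 < deg β u
  adjacent⇒deg-pos {β} {u} {v} adjacent ov = ℕ.≤-trans (ℕ.≤-reflexive (sym term)) (≤-∑ _ v)
    where
    term : A G u v ℕ.* indicator β v ≡ 1
    term rewrite adjacent | restrict-in (λ _ → 1) ov = refl

Equitable : ∀ {n} → Graph n → (Fin n → Bool) → Set
Equitable G o = ∀ β {u v} → o u ≡ o v → deg β u ≡ deg β v
  where open NatCells G o

CompletelyJoined : ∀ {n} → Graph n → (Fin n → Bool) → Set
CompletelyJoined G o = ∀ {u v} → o u ≢ o v → adj G u v ≡ true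

ℚ-commutativeSemiring : CommutativeSemiring 0ℓ 0ℓ
ℚ-commutativeSemiring = CommutativeRing.commutativeSemiring ℚ.+-*-commutativeRing

module ℚ∑ = SemiringSum (CommutativeSemiring.semiring ℚ-commutativeSemiring)
module ℚA = AdjacencyAlgebra ℚ-commutativeSemiring
open Cast ℚ-commutativeSemiring using (cast; cast-*; cast-deg)

sumℚ≡∑ : ∀ {m} (f : Fin m → ℚ) → sumℚ f ≡ ℚ∑.sum f
sumℚ≡∑ {zero}  f = refl
sumℚ≡∑ {suc m} f = cong (f zero ℚ.+_) (sumℚ≡∑ (f ∘ suc))

inKernel⇒adjMul≡0 : ∀ {n} {G : Graph n} {x} → InKernel G x → ∀ u → ℚA.adjMul G x u ≡ 0ℚ
inKernel⇒adjMul≡0 {G = G} {x} ker u = trans (sym (sumℚ≡∑ (λ v → adjMat G u v ℚ.* x v))) (ker u)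

adjMul≡0⇒inKernel : ∀ {n} {G : Graph n} {x} → (∀ u → ℚA.adjMul G x u ≡ 0ℚ) → InKernel G x
adjMul≡0⇒inKernel {G = G} {x} Ax≡0 u = trans (sumℚ≡∑ (λ v → adjMat G u v ℚ.* x v)) (Ax≡0 u)

cast-nonNeg : ∀ m → 0ℚ ℚ.≤ cast m
cast-nonNeg zero    = ℚ.≤-refl
cast-nonNeg (suc m) = ℚ.+-mono-≤ (ℚ.nonNegative⁻¹ 1ℚ) (cast-nonNeg m)

cast-mono-< : ∀ {m k} → m < k → cast m ℚ.< cast k
cast-mono-< {zero}  {suc k} _         = ℚ.+-mono-<-≤ (ℚ.positive⁻¹ 1ℚ) (cast-nonNeg k)
cast-mono-< {suc m} {suc k} (s≤s m<k) = ℚ.+-monoʳ-< 1ℚ (cast-mono-< m<k)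

p*q≡0⇒q≡0 : ∀ {p q} → p ≢ 0ℚ → p ℚ.* q ≡ 0ℚ → q ≡ 0ℚ
p*q≡0⇒q≡0 {p} {q} p≢0 pq≡0 = begin
  q                    ≡⟨ ℚ.*-identityˡ q ⟨
  1ℚ ℚ.* q             ≡⟨ cong (ℚ._* q) (ℚ.*-inverseˡ p) ⟨
  (p⁻¹ ℚ.* p) ℚ.* q    ≡⟨ ℚ.*-assoc p⁻¹ p q ⟩
  p⁻¹ ℚ.* (p ℚ.* q)    ≡⟨ cong (p⁻¹ ℚ.*_) pq≡0 ⟩
  p⁻¹ ℚ.* 0ℚ           ≡⟨ ℚ.*-zeroʳ p⁻¹ ⟩
  0ℚ                   ∎
  where
  open ≡.≡-Reasoning
  instance
    p-nonZero : ℚ.NonZero p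
    p-nonZero = ℚ.≢-nonZero p≢0
  p⁻¹ : ℚ
  p⁻¹ = ℚ.1/ p

module _ {p q r s x y : ℚ} where

  open import Data.Rational using (_+_; _*_; _-_)
  open +-*-Solver

  2×2-det≢0⇒zero-solution : p * s ≢ q * r → x * p + y * q ≡ 0ℚ → x * r + y * s ≡ 0ℚ →
                            x ≡ 0ℚ × y ≡ 0ℚ
  2×2-det≢0⇒zero-solution det≢0 e₁ e₂ =
    p*q≡0⇒q≡0 det'≢0 (trans det*x (combination≡0 s q e₁ e₂)) ,
    p*q≡0⇒q≡0 det'≢0 (trans det*y (combination≡0 p r e₂ e₁))
    where
    det'≢0 : p * s - q * r ≢ 0ℚ
    det'≢0 = det≢0 ∘ x∙y⁻¹≈ε⇒x≈y (p * s) (q * r)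
    det*x : (p * s - q * r) * x ≡ s * (x * p + y * q) - q * (x * r + y * s)
    det*x = solve 6 (λ p q r s x y →
                      (p :* s :- q :* r) :* x := s :* (x :* p :+ y :* q) :- q :* (x :* r :+ y :* s))
                    refl p q r s x y
    det*y : (p * s - q * r) * y ≡ p * (x * r + y * s) - r * (x * p + y * q)
    det*y = solve 6 (λ p q r s x y →
                      (p :* s :- q :* r) :* y := p :* (x :* r :+ y :* s) :- r :* (x :* p :+ y :* q))
                    refl p q r s x y
    combination≡0 : ∀ c d {a b} → a ≡ 0ℚ → b ≡ 0ℚ → c * a - d * b ≡ 0ℚ
    combination≡0 c d refl refl = solve 2 (λ c d → c :* con 0ℚ :- d :* con 0ℚ := con 0ℚ) refl c d

nut-kernel-vanishing : ∀ {n} {G : Graph n} → IsNut G →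
                       ∀ {y} → InKernel G y → ∀ {v} → y v ≡ 0ℚ → ∀ w → y w ≡ 0ℚ
nut-kernel-vanishing (_ , x , _ , x≢0 , spans) {y} y-ker {v} yv≡0 w with spans y y-ker
... | k , y≡kx = trans (y≡kx w) (trans (cong (ℚ._* x w) k≡0) (ℚ.*-zeroˡ (x w)))
  where
  k≡0 : k ≡ 0ℚ
  k≡0 = p*q≡0⇒q≡0 (x≢0 v) (trans (ℚ.*-comm (x v) k) (trans (sym (y≡kx v)) yv≡0))

module EquitableBipartition {n : ℕ} {G : Graph n} {o : Fin n → Bool} {a b : Fin n}
  (o-a : o a ≡ true) (o-b : o b ≡ false) (equitable : Equitable G o) where

  open NatCells G o
  module ℚC = ℚA.Cells G o

  rep : Bool → Fin n
  rep true  = a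
  rep false = b

  o-rep : ∀ γ → o (rep γ) ≡ γ
  o-rep true  = o-a
  o-rep false = o-b

  quotient : Bool → Bool → ℕ
  quotient γ β = deg β (rep γ)

  deg-quotient : ∀ β v → deg β v ≡ quotient (o v) β
  deg-quotient β v = equitable β (sym (o-rep (o v)))

  deg-cell : ∀ {γ} β v → o v ≡ γ → deg β v ≡ quotient γ β
  deg-cell β v ov = trans (deg-quotient β v) (cong (λ γ → quotient γ β) ov)

  quotient-diag-< : ∀ γ → quotient γ γ < size γ
  quotient-diag-< γ = deg-<-size (o-rep γ) (irrefl G (rep γ))

  double-counting : size true ℕ.* quotient true false ≡ size false ℕ.* quotient false true
  double-counting = begin
    size true ℕ.* quotient true false   ≡⟨ cellSum-const true (deg-cell false) ⟨
    cellSum true (deg false)            ≡⟨ cellSum-deg-comm true false ⟩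
    cellSum false (deg true)            ≡⟨ cellSum-const false (deg-cell true) ⟩
    size false ℕ.* quotient false true  ∎
    where open ≡.≡-Reasoning

  true-cell-closed : quotient true false ≡ 0 → ∀ {u v} → adj G u v ≡ true → o u ≡ true → o v ≡ true
  true-cell-closed q≡0 {u} {v} adjacent ou with o v in ov
  ... | true  = refl
  ... | false = ⊥-elim (ℕ.<-irrefl (sym (trans (deg-cell false u ou) q≡0)) (adjacent⇒deg-pos adjacent ov))

  connected⇒quotient≢0 : (∀ u v → Reachable G u v) → quotient true false ≢ 0
  connected⇒quotient≢0 reach q≡0 =
    not-¬ o-b (reachable-closed (λ v → o v ≡ true) (true-cell-closed q≡0) (reach a b) o-a)

  prime⇒quotient≡size : Connected G → Prime n → quotient true false ≡ size false
  prime⇒quotient≡size (_ , reach) p =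
    prime-sum-divisor (subst Prime (sym size-cells) p) (size-pos o-a)
      (ℕ.n≢0⇒n>0 (connected⇒quotient≢0 reach)) (deg-≤-size false a)
      (divides (quotient false true) (trans double-counting (ℕ.*-comm (size false) _)))

  prime⇒cells-joined : Connected G → Prime n → ∀ {u v} → o u ≡ true → o v ≡ false → adj G u v ≡ true
  prime⇒cells-joined conn p {u} ou =
    deg≡size⇒adjacent (trans (deg-cell false u ou) (prime⇒quotient≡size conn p))

  prime⇒completelyJoined : Connected G → Prime n → CompletelyJoined G o
  prime⇒completelyJoined conn p {u} {v} ou≢ov with o u in ou | o v in ov
  ... | true  | true  = ⊥-elim (ou≢ov refl)
  ... | false | false = ⊥-elim (ou≢ov refl)
  ... | true  | false = prime⇒cells-joined conn p ou ov
  ... | false | true  = trans (symm G u v) (prime⇒cells-joined conn p ov ou)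

  joined⇒adjacent : CompletelyJoined G o → ∀ {β u} → o u ≡ not β → ∀ v → o v ≡ β → adj G u v ≡ true
  joined⇒adjacent joined ou v ov = joined (λ eq → not-¬ ov (trans (sym eq) ou))

  joined⇒quotient≡size : CompletelyJoined G o → ∀ β → quotient (not β) β ≡ size β
  joined⇒quotient≡size joined β =
    adjMul-restrict-joined β (λ _ → 1) (rep (not β)) (joined⇒adjacent joined (o-rep (not β)))

  ℚdeg-quotient : ∀ β v → ℚC.deg β v ≡ cast (quotient (o v) β)
  ℚdeg-quotient β v = trans (sym (cast-deg G o β v)) (cong cast (deg-quotient β v))

  kernel-cell-equation : ∀ {x} → InKernel G x → ∀ β →
    ℚC.cellSum true x ℚ.* cast (quotient true β) ℚ.+ ℚC.cellSum false x ℚ.* cast (quotient false β) ≡ 0ℚ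
  kernel-cell-equation {x} ker β = begin
    ℚC.cellSum true x ℚ.* cast (quotient true β) ℚ.+ ℚC.cellSum false x ℚ.* cast (quotient false β)
      ≡⟨ ℚC.∑-cellwise x (λ γ → cast (quotient γ β)) (ℚdeg-quotient β) ⟨
    ℚ∑.sum (λ v → x v ℚ.* ℚC.deg β v)  ≡⟨ ℚC.cellSum-adjMul β x ⟨
    ℚC.cellSum β (ℚA.adjMul G x)       ≡⟨ ℚC.cellSum-zero β (inKernel⇒adjMul≡0 {G = G} ker) ⟩
    0ℚ                                 ∎
    where open ≡.≡-Reasoning

  joined⇒cellSums≡0 : CompletelyJoined G o → ∀ {x} → InKernel G x →
                      ℚC.cellSum true x ≡ 0ℚ × ℚC.cellSum false x ≡ 0ℚ
  joined⇒cellSums≡0 joined ker =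
    2×2-det≢0⇒zero-solution det≢0 (kernel-cell-equation ker true) (kernel-cell-equation ker false)
    where
    diag<offdiag : ∀ γ → quotient γ γ < quotient (not γ) γ
    diag<offdiag γ = subst (quotient γ γ <_) (sym (joined⇒quotient≡size joined γ)) (quotient-diag-< γ)
    det≢0 : cast (quotient true true) ℚ.* cast (quotient false false) ≢
            cast (quotient false true) ℚ.* cast (quotient true false)
    det≢0 = ℚ.<⇒≢ (subst₂ ℚ._<_ (cast-* (quotient true true) (quotient false false))
                                 (cast-* (quotient false true) (quotient true false))
                     (cast-mono-< (ℕ.*-mono-< (diag<offdiag true) (diag<offdiag false))))

  restrict-inKernel : CompletelyJoined G o → ∀ {x} → InKernel G x →
                      ℚC.cellSum true x ≡ 0ℚ → ℚC.cellSum false x ≡ 0ℚ → InKernel G (ℚC.restrict true x)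
  restrict-inKernel joined {x} ker S₁≡0 S₂≡0 = adjMul≡0⇒inKernel {G = G} Ay≡0
    where
    y z : Fin n → ℚ
    y = ℚC.restrict true x
    z = ℚC.restrict false x
    A· : (Fin n → ℚ) → Fin n → ℚ
    A· = ℚA.adjMul G
    Ay≡0 : ∀ u → A· y u ≡ 0ℚ
    Ay≡0 u with o u in ou
    ... | true  = begin
      A· y u             ≡⟨ ℚ.+-identityʳ (A· y u) ⟨
      A· y u ℚ.+ 0ℚ      ≡⟨ cong (A· y u ℚ.+_) Az≡0 ⟨
      A· y u ℚ.+ A· z u  ≡⟨ ℚC.adjMul-cells x u ⟨
      A· x u             ≡⟨ inKernel⇒adjMul≡0 {G = G} ker u ⟩
      0ℚ                 ∎
      where
      open ≡.≡-Reasoning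
      Az≡0 : A· z u ≡ 0ℚ
      Az≡0 = trans (ℚC.adjMul-restrict-joined false x u (joined⇒adjacent joined ou)) S₂≡0
    ... | false = trans (ℚC.adjMul-restrict-joined true x u (joined⇒adjacent joined ou)) S₁≡0

  nut⇒¬prime : IsNut G → ¬ Prime n
  nut⇒¬prime nut@(conn , x , ker , x≢0 , _) p = x≢0 a (trans (sym (ℚC.restrict-in x o-a)) (y≡0 a))
    where
    joined : CompletelyJoined G o
    joined = prime⇒completelyJoined conn p
    S≡0 : ℚC.cellSum true x ≡ 0ℚ × ℚC.cellSum false x ≡ 0ℚ
    S≡0 = joined⇒cellSums≡0 joined ker
    y≡0 : ∀ w → ℚC.restrict true x w ≡ 0ℚ
    y≡0 = nut-kernel-vanishing nut (restrict-inKernel joined ker (proj₁ S≡0) (proj₂ S≡0))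
            (ℚC.restrict-out x (not-¬ o-b))

module _ {n : ℕ} (G : Graph n) where

  sameOrbit-refl : ∀ {u} → SameOrbit G u u
  sameOrbit-refl = Perm.id , (λ _ _ → refl) , refl

  sameOrbit-sym : ∀ {u v} → SameOrbit G u v → SameOrbit G v u
  sameOrbit-sym (π , aut , refl) = Perm.flip π , aut⁻¹ , Perm.inverseˡ π
    where
    aut⁻¹ : IsAutomorphism G (Perm.flip π)
    aut⁻¹ u v = trans (sym (aut (π ⟨$⟩ˡ u) (π ⟨$⟩ˡ v)))
                      (≡.cong₂ (adj G) (Perm.inverseʳ π) (Perm.inverseʳ π))

  sameOrbit-trans : ∀ {u v w} → SameOrbit G u v → SameOrbit G v w → SameOrbit G u w
  sameOrbit-trans (π , aut , refl) (σ , aut′ , refl) =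
    π ∘ₚ σ , (λ u v → trans (aut′ (π ⟨$⟩ʳ u) (π ⟨$⟩ʳ v)) (aut u v)) , refl

module OrbitColouring {n : ℕ} (G : Graph n) {a b : Fin n} (a≁b : ¬ SameOrbit G a b)
  (cover : ∀ v → SameOrbit G a v ⊎ SameOrbit G b v) (dec : ∀ v → Dec (SameOrbit G a v)) where

  colour : Fin n → Bool
  colour v = does (dec v)

  colour-a : colour a ≡ true
  colour-a with dec a
  ... | yes _   = refl
  ... | no  a≁a = ⊥-elim (a≁a (sameOrbit-refl G))

  colour-b : colour b ≡ false
  colour-b with dec b
  ... | yes a~b = ⊥-elim (a≁b a~b)
  ... | no  _   = refl

  sameOrbit⇒colour≡ : ∀ {u v} → SameOrbit G u v → colour u ≡ colour v
  sameOrbit⇒colour≡ {u} {v} u~v with dec u | dec v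
  ... | yes _   | yes _   = refl
  ... | no  _   | no  _   = refl
  ... | yes a~u | no  a≁v = ⊥-elim (a≁v (sameOrbit-trans G a~u u~v))
  ... | no  a≁u | yes a~v = ⊥-elim (a≁u (sameOrbit-trans G a~v (sameOrbit-sym G u~v)))

  colour≡⇒sameOrbit : ∀ {u v} → colour u ≡ colour v → SameOrbit G u v
  colour≡⇒sameOrbit {u} {v} with dec u | dec v
  ... | yes a~u | yes a~v = λ _ → sameOrbit-trans G (sameOrbit-sym G a~u) a~v
  ... | no  a≁u | no  a≁v = λ _ → sameOrbit-trans G (sameOrbit-sym G (b-orbit a≁u)) (b-orbit a≁v)
    where
    b-orbit : ∀ {w} → ¬ SameOrbit G a w → SameOrbit G b w
    b-orbit {w} a≁w = [ ⊥-elim ∘ a≁w , id ] (cover w)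
  ... | yes _   | no  _   = λ ()
  ... | no  _   | yes _   = λ ()

  colour-equitable : Equitable G colour
  colour-equitable β cu≡cv with colour≡⇒sameOrbit cu≡cv
  ... | π , aut , refl =
    sym (deg-automorphism {π} aut (λ w → sym (sameOrbit⇒colour≡ (π , aut , refl))) β _)
    where open NatCells G colour

-- Orbit membership need not be decidable constructively, but the goal is a negation, so a decision procedure
-- may be assumed under double negation.
¬¬-decidable : ∀ {n} (P : Fin n → Set) → ¬ ¬ (∀ v → Dec (P v))
¬¬-decidable P = sequence (RawMonad.rawApplicative ¬¬-Monad) (λ _ → ¬¬-excluded-middle)

theorem19 : (n : ℕ) (G : Graph n) → IsNut G → HasTwoOrbits G → ¬ Prime n
theorem19 n G nut (a , b , a≁b , cover) p =
  ¬¬-decidable (SameOrbit G a) λ dec →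
    let open OrbitColouring G a≁b cover dec in
    EquitableBipartition.nut⇒¬prime colour-a colour-b colour-equitable nut p
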